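{- Let $S$ and $T$ be sights and $d=\langle d_1,\ldots,d_n\rangle\in\mathrm{Tr}(S)\cap\mathrm{Tr}(T)$. If some number $z$ is r-defined on both $S$ and $T$ and $d$ is a good leaf of $S$, then $d$ is also a good leaf of $T$.
   Context: Notation: $ex$ is the (possibly undefined) result of applying the $e$-th partial recursive function to $x$; $\langle\ldots\rangle$ codes finite sequences, $\ast$ is concatenation; $A\wedge C=\{\langle a,c\rangle\mid a\in A,c\in C\}$. A sight is, inductively, either NIL, or a pair $(A,\sigma)$ with $A\subseteq\mathbb N$ and $\sigma$ a function on $A$ whose values are sights. Tree $\mathrm{Tr}(S)$ with good leaves: for NIL, $\{\langle\rangle\}$ with $\langle\rangle$ good; for $(\emptyset,\emptyset)$, $\{\langle\rangle\}$ with no good leaf; for $(A,\sigma)$, $A\ne\emptyset$, $\{\langle\rangle\}\cup\{\langle a\rangle\ast t\mid a\in A,t\in\mathrm{Tr}(\sigma(a))\}$ with $\langle a\rangle\ast t$ good iff $t$ is a good leaf of $\mathrm{Tr}(\sigma(a))$. For nonempty $B\subseteq\mathbb N$, $\theta:B\to\mathcal P^*\mathcal P(\mathbb N)$ and $p\subseteq\mathbb N$, a sight $S$ is $(z,\theta,p)$-dedicated if either $S=\mathrm{NIL}$ and $z\in\{0\}\wedge p$, or $S=(A,\sigma)$, $z=\langle1,\langle n,e\rangle\rangle$, $n\in B$, $A\in\theta(n)$, and for all $a\in A$, $ea$ is defined and $\sigma(a)$ is $(ea,\theta,p)$-dedicated. A number $z$ is r-defined on $S$ if for some such $\theta$, $S$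 is $(z,\theta,\mathbb N)$-dedicated. -}

module Defs where

open import Data.Nat using (ℕ; zero; suc; _+_; _<_)
open import Data.Fin using (Fin)
open import Data.List using (List; []; _∷_)
open import Data.Maybe using (Maybe; just; nothing)
open import Data.Product using (Σ; _×_; _,_)
open import Data.Unit using (⊤)
open import Data.Empty using (⊥)
open import Relation.Binary.PropositionalEquality using (_≡_)

tri : ℕ → ℕ
tri zero    = 0
tri (suc n) = suc n + tri n

-- Cantor pairing  π(x,y) = (x+y)(x+y+1)/2 + y
cpair : ℕ → ℕ → ℕ
cpair x y = tri (x + y) + y

⟪_⟫ : List ℕ → ℕ
⟪ [] ⟫     = 0
⟪ x ∷ xs ⟫ = suc (cpair x ⟪ xs ⟫)

⟨_,_⟩ : ℕ → ℕ → ℕ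
⟨ a , c ⟩ = ⟪ a ∷ c ∷ [] ⟫

data Code : Set where
  Zc : Code
  Sc : Code
  Pc : ℕ → Code
  Cc : Code → List Code → Code  -- composition  f(g₁(x⃗),…,gₖ(x⃗))
  Rc : Code → Code → Code       -- primitive recursion on first argument
  Mc : Code → Code              -- minimisation on first argument

mutual
  encode : Code → ℕ
  encode Zc        = ⟨ 0 , 0 ⟩
  encode Sc        = ⟨ 1 , 0 ⟩
  encode (Pc i)    = ⟨ 2 , i ⟩
  encode (Cc f gs) = ⟨ 3 , ⟨ encode f , encodeList gs ⟩ ⟩
  encode (Rc f g)  = ⟨ 4 , ⟨ encode f , encode g ⟩ ⟩
  encode (Mc f)    = ⟨ 5 , encode f ⟩

  encodeList : List Code → ℕ
  encodeList []       = 0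
  encodeList (g ∷ gs) = suc (cpair (encode g) (encodeList gs))

lookupL : List ℕ → ℕ → Maybe ℕ
lookupL []       _       = nothing
lookupL (x ∷ xs) zero    = just x
lookupL (x ∷ xs) (suc i) = lookupL xs i

mutual
  data Eval : Code → List ℕ → ℕ → Set where
    ev-Z  : ∀ {xs} → Eval Zc xs 0
    ev-S  : ∀ {x xs} → Eval Sc (x ∷ xs) (suc x)
    ev-P  : ∀ {i xs y} → lookupL xs i ≡ just y → Eval (Pc i) xs y
    ev-C  : ∀ {f gs xs ys y} → EvalList gs xs ys → Eval f ys y → Eval (Cc f gs) xs y
    ev-R0 : ∀ {f g xs y} → Eval f xs y → Eval (Rc f g) (0 ∷ xs) y
    ev-RS : ∀ {f g k xs r y} → Eval (Rc f g) (k ∷ xs) r → Eval g (k ∷ r ∷ xs) y →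
            Eval (Rc f g) (suc k ∷ xs) y
    ev-M  : ∀ {f xs k} → Eval f (k ∷ xs) 0 →
            ((j : ℕ) → j < k → Σ ℕ (λ r → Eval f (j ∷ xs) (suc r))) →
            Eval (Mc f) xs k

  data EvalList : List Code → List ℕ → List ℕ → Set where
    evl-[] : ∀ {xs} → EvalList [] xs []
    evl-∷  : ∀ {g gs xs y ys} → Eval g xs y → EvalList gs xs ys → EvalList (g ∷ gs) xs (y ∷ ys)

-- Kleene application:  e x ≃ y  iff  e is the Gödel number of a term
-- computing y on input x.  (Numbers not of the form encode c index the
-- nowhere-defined function.)
_·_≃_ : ℕ → ℕ → ℕ → Set
e · x ≃ y = Σ Code (λ c → (encode c ≡ e) × Eval c (x ∷ []) y)

-- Sights.  A subset of ℕ is a predicate ℕ → Set; σ is a function on A.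

data Sight : Set₁ where
  NIL  : Sight
  node : (A : ℕ → Set) → ((a : ℕ) → A a → Sight) → Sight

InTr : Sight → List ℕ → Set
InTr NIL        []      = ⊤
InTr NIL        (_ ∷ _) = ⊥
InTr (node A σ) []      = ⊤
InTr (node A σ) (a ∷ t) = Σ (A a) (λ h → InTr (σ a h) t)

GoodLeaf : Sight → List ℕ → Set
GoodLeaf NIL        []      = ⊤
GoodLeaf NIL        (_ ∷ _) = ⊥
GoodLeaf (node A σ) []      = ⊥
GoodLeaf (node A σ) (a ∷ t) = Σ (A a) (λ h → GoodLeaf (σ a h) t)

-- S is (z, θ, p)-dedicated, θ : B → 𝒫*𝒫(ℕ)
Dedicated : {B : ℕ → Set} → ((n : ℕ) → B n → (ℕ → Set) → Set) → (ℕ → Set) →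
            ℕ → Sight → Set
Dedicated θ p z NIL = Σ ℕ (λ c → p c × (z ≡ ⟨ 0 , c ⟩))
Dedicated {B} θ p z (node A σ) =
  Σ ℕ (λ n → Σ ℕ (λ e →
    (z ≡ ⟨ 1 , ⟨ n , e ⟩ ⟩) ×
    Σ (B n) (λ bn → θ n bn A ×
      ((a : ℕ) (h : A a) → Σ ℕ (λ r → (e · a ≃ r) × Dedicated θ p r (σ a h))))))

-- z is r-defined on S: for some nonempty B and θ : B → 𝒫*𝒫(ℕ)
-- (𝒫* = nonempty subsets), S is (z, θ, ℕ)-dedicated.
RDefined : ℕ → Sight → Set₁
RDefined z S =
  Σ (ℕ → Set) (λ B →
    Σ ℕ B ×
    Σ ((n : ℕ) → B n → (ℕ → Set) → Set) (λ θ →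
      ((n : ℕ) (b : B n) → Σ (ℕ → Set) (λ A → θ n b A)) ×
      Dedicated θ (λ _ → ⊤) z S))

-- A code z dedicating a sight fixes its shape along every path: the first
-- component of z tells NIL (tag 0) from a node (tag 1), and at a node z fixes
-- an index e whose value ea is the code dedicating the subsight at a. Since
-- sequence coding and the Gödel numbering of terms are injective and term
-- evaluation is deterministic, ea is the same whether computed for S or for T.
-- So along d the two sights agree on being NIL, in particular at the last
-- vertex, which is what makes d a good leaf.
module Submission where

open import Defs
open import Data.Nat using (ℕ; suc; _+_; _≤_; _<_; z≤n; s≤s)
open import Data.Nat.Properties
open import Data.List using (List; []; _∷_)
open import Data.Maybe.Properties using (just-injective)
open import Data.Product using (_×_; _,_; proj₁; proj₂)
open import Data.Unit using (tt)
open import Relation.Binary.Definitions using (tri<; tri≈; tri>)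
open import Relation.Binary.PropositionalEquality
open import Relation.Nullary using (¬_; contradiction)

tri-mono-≤ : ∀ {m n} → m ≤ n → tri m ≤ tri n
tri-mono-≤ z≤n       = z≤n
tri-mono-≤ (s≤s m≤n) = +-mono-≤ (s≤s m≤n) (tri-mono-≤ m≤n)

tri+<tri-suc : ∀ {s y} → y ≤ s → tri s + y < tri (suc s)
tri+<tri-suc {s} {y} y≤s = begin-strict
  tri s + y  ≤⟨ +-monoʳ-≤ (tri s) y≤s ⟩
  tri s + s  ≡⟨ +-comm (tri s) s ⟩
  s + tri s  <⟨ n<1+n (s + tri s) ⟩
  tri (suc s) ∎
  where open ≤-Reasoning

cpair-< : ∀ x y x' y' → x + y < x' + y' → cpair x y < cpair x' y'
cpair-< x y x' y' lt = begin-strict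
  tri (x + y) + y     <⟨ tri+<tri-suc (m≤n+m y x) ⟩
  tri (suc (x + y))   ≤⟨ tri-mono-≤ lt ⟩
  tri (x' + y')       ≤⟨ m≤m+n (tri (x' + y')) y' ⟩
  tri (x' + y') + y'  ∎
  where open ≤-Reasoning

cpair-injective : ∀ x y x' y' → cpair x y ≡ cpair x' y' → x ≡ x' × y ≡ y'
cpair-injective x y x' y' eq with <-cmp (x + y) (x' + y')
... | tri< lt _ _ = contradiction eq (<⇒≢ (cpair-< x y x' y' lt))
... | tri> _ _ gt = contradiction (sym eq) (<⇒≢ (cpair-< x' y' x y gt))
... | tri≈ _ sum≡ _ = x≡x' , y≡y'
  where
  y≡y' : y ≡ y'
  y≡y' = +-cancelˡ-≡ (tri (x + y)) y y' (trans eq (cong (λ s → tri s + y') (sym sum≡)))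
  x≡x' : x ≡ x'
  x≡x' = +-cancelʳ-≡ y x x' (trans sum≡ (cong (x' +_) (sym y≡y')))

⟪⟫-injective : ∀ xs ys → ⟪ xs ⟫ ≡ ⟪ ys ⟫ → xs ≡ ys
⟪⟫-injective []       []       _  = refl
⟪⟫-injective (x ∷ xs) (y ∷ ys) eq with cpair-injective x ⟪ xs ⟫ y ⟪ ys ⟫ (suc-injective eq)
... | refl , codes≡ = cong (x ∷_) (⟪⟫-injective xs ys codes≡)

⟨,⟩-injective : ∀ a b c d → ⟨ a , b ⟩ ≡ ⟨ c , d ⟩ → a ≡ c × b ≡ d
⟨,⟩-injective a b c d eq with ⟪⟫-injective (a ∷ b ∷ []) (c ∷ d ∷ []) eq
... | refl = refl , refl

⟨0,-⟩≢⟨1,-⟩ : ∀ a b → ¬ ⟨ 0 , a ⟩ ≡ ⟨ 1 , b ⟩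
⟨0,-⟩≢⟨1,-⟩ a b eq = 0≢1+n (proj₁ (⟨,⟩-injective 0 a 1 b eq))

node-index-injective : ∀ n e n' e' → ⟨ 1 , ⟨ n , e ⟩ ⟩ ≡ ⟨ 1 , ⟨ n' , e' ⟩ ⟩ → e ≡ e'
node-index-injective n e n' e' eq =
  proj₂ (⟨,⟩-injective n e n' e' (proj₂ (⟨,⟩-injective 1 ⟨ n , e ⟩ 1 ⟨ n' , e' ⟩ eq)))

tag : Code → ℕ
tag Zc       = 0
tag Sc       = 1
tag (Pc _)   = 2
tag (Cc _ _) = 3
tag (Rc _ _) = 4
tag (Mc _)   = 5

body : Code → ℕ
body Zc        = 0
body Sc        = 0
body (Pc i)    = i
body (Cc f gs) = ⟨ encode f , encodeList gs ⟩
body (Rc f g)  = ⟨ encode f , encode g ⟩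
body (Mc f)    = encode f

encode≡⟨tag,body⟩ : ∀ c → encode c ≡ ⟨ tag c , body c ⟩
encode≡⟨tag,body⟩ Zc       = refl
encode≡⟨tag,body⟩ Sc       = refl
encode≡⟨tag,body⟩ (Pc _)   = refl
encode≡⟨tag,body⟩ (Cc _ _) = refl
encode≡⟨tag,body⟩ (Rc _ _) = refl
encode≡⟨tag,body⟩ (Mc _)   = refl

mutual
  encode-injective : ∀ c c' → encode c ≡ encode c' → c ≡ c'
  encode-injective c c' eq =
    tag-body-injective c c' (⟨,⟩-injective (tag c) (body c) (tag c') (body c') (begin
      ⟨ tag c , body c ⟩    ≡⟨ encode≡⟨tag,body⟩ c ⟨
      encode c              ≡⟨ eq ⟩
      encode c'             ≡⟨ encode≡⟨tag,body⟩ c' ⟩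
      ⟨ tag c' , body c' ⟩  ∎))
    where open ≡-Reasoning

  encodeList-injective : ∀ gs gs' → encodeList gs ≡ encodeList gs' → gs ≡ gs'
  encodeList-injective []       []         _  = refl
  encodeList-injective (g ∷ gs) (g' ∷ gs') eq =
    let g≡ , gs≡ = cpair-injective (encode g) (encodeList gs) (encode g') (encodeList gs') (suc-injective eq)
    in  cong₂ _∷_ (encode-injective g g' g≡) (encodeList-injective gs gs' gs≡)

  tag-body-injective : ∀ c c' → tag c ≡ tag c' × body c ≡ body c' → c ≡ c'
  tag-body-injective Zc        Zc          _       = refl
  tag-body-injective Sc        Sc          _       = refl
  tag-body-injective (Pc i)    (Pc j)      (_ , i≡j) = cong Pc i≡j
  tag-body-injective (Cc f gs) (Cc f' gs') (_ , eq) =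
    let f≡ , gs≡ = ⟨,⟩-injective (encode f) (encodeList gs) (encode f') (encodeList gs') eq
    in  cong₂ Cc (encode-injective f f' f≡) (encodeList-injective gs gs' gs≡)
  tag-body-injective (Rc f g)  (Rc f' g')  (_ , eq) =
    let f≡ , g≡ = ⟨,⟩-injective (encode f) (encode g) (encode f') (encode g') eq
    in  cong₂ Rc (encode-injective f f' f≡) (encode-injective g g' g≡)
  tag-body-injective (Mc f)    (Mc f')     (_ , f≡) = cong Mc (encode-injective f f' f≡)
  tag-body-injective Zc       Sc       (() , _)
  tag-body-injective Zc       (Pc _)   (() , _)
  tag-body-injective Zc       (Cc _ _) (() , _)
  tag-body-injective Zc       (Rc _ _) (() , _)
  tag-body-injective Zc       (Mc _)   (() , _)
  tag-body-injective Sc       Zc       (() , _)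
  tag-body-injective Sc       (Pc _)   (() , _)
  tag-body-injective Sc       (Cc _ _) (() , _)
  tag-body-injective Sc       (Rc _ _) (() , _)
  tag-body-injective Sc       (Mc _)   (() , _)
  tag-body-injective (Pc _)   Zc       (() , _)
  tag-body-injective (Pc _)   Sc       (() , _)
  tag-body-injective (Pc _)   (Cc _ _) (() , _)
  tag-body-injective (Pc _)   (Rc _ _) (() , _)
  tag-body-injective (Pc _)   (Mc _)   (() , _)
  tag-body-injective (Cc _ _) Zc       (() , _)
  tag-body-injective (Cc _ _) Sc       (() , _)
  tag-body-injective (Cc _ _) (Pc _)   (() , _)
  tag-body-injective (Cc _ _) (Rc _ _) (() , _)
  tag-body-injective (Cc _ _) (Mc _)   (() , _)
  tag-body-injective (Rc _ _) Zc       (() , _)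
  tag-body-injective (Rc _ _) Sc       (() , _)
  tag-body-injective (Rc _ _) (Pc _)   (() , _)
  tag-body-injective (Rc _ _) (Cc _ _) (() , _)
  tag-body-injective (Rc _ _) (Mc _)   (() , _)
  tag-body-injective (Mc _)   Zc       (() , _)
  tag-body-injective (Mc _)   Sc       (() , _)
  tag-body-injective (Mc _)   (Pc _)   (() , _)
  tag-body-injective (Mc _)   (Cc _ _) (() , _)
  tag-body-injective (Mc _)   (Rc _ _) (() , _)

mutual
  Eval-functional : ∀ {c xs y y'} → Eval c xs y → Eval c xs y' → y ≡ y'
  Eval-functional ev-Z ev-Z = refl
  Eval-functional ev-S ev-S = refl
  Eval-functional (ev-P lookup≡) (ev-P lookup≡') = just-injective (trans (sym lookup≡) lookup≡')
  Eval-functional (ev-C args f) (ev-C args' f') with EvalList-functional args args'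
  ... | refl = Eval-functional f f'
  Eval-functional (ev-R0 f) (ev-R0 f') = Eval-functional f f'
  Eval-functional (ev-RS rec g) (ev-RS rec' g') with Eval-functional rec rec'
  ... | refl = Eval-functional g g'
  Eval-functional (ev-M {k = k} root below) (ev-M {k = k'} root' below') with <-cmp k k'
  ... | tri≈ _ k≡k' _ = k≡k'
  ... | tri< k<k' _ _ = contradiction (Eval-functional root (proj₂ (below' k k<k'))) 0≢1+n
  ... | tri> _ _ k>k' = contradiction (Eval-functional root' (proj₂ (below k' k>k'))) 0≢1+n

  EvalList-functional : ∀ {gs xs ys ys'} → EvalList gs xs ys → EvalList gs xs ys' → ys ≡ ys'
  EvalList-functional evl-[]       evl-[]         = refl
  EvalList-functional (evl-∷ g gs) (evl-∷ g' gs') =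
    cong₂ _∷_ (Eval-functional g g') (EvalList-functional gs gs')

·≃-functional : ∀ {e x y y'} → e · x ≃ y → e · x ≃ y' → y ≡ y'
·≃-functional (c , refl , ev) (c' , c'≡ , ev') with encode-injective c c' (sym c'≡)
... | refl = Eval-functional ev ev'

dedicated-goodLeaf-transfer :
  ∀ {B B' : ℕ → Set} {θ : (n : ℕ) → B n → (ℕ → Set) → Set}
    {θ' : (n : ℕ) → B' n → (ℕ → Set) → Set} {p p' : ℕ → Set} {z}
  (S T : Sight) (d : List ℕ) →
  Dedicated θ p z S → Dedicated θ' p' z T →
  InTr T d → GoodLeaf S d → GoodLeaf T d
dedicated-goodLeaf-transfer NIL NIL [] _ _ _ _ = tt
dedicated-goodLeaf-transfer NIL (node _ _) [] (c , _ , refl) (n , e , z≡ , _) _ _ =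
  contradiction z≡ (⟨0,-⟩≢⟨1,-⟩ c ⟨ n , e ⟩)
dedicated-goodLeaf-transfer (node A σ) (node A' σ') (a ∷ t)
  (n , e , refl , _ , _ , childS) (n' , e' , z≡ , _ , _ , childT) (h' , t∈T) (h , good)
  with node-index-injective n e n' e' z≡
... | refl with childS a h | childT a h'
...   | r , ea≃r , dedS | r' , ea≃r' , dedT with ·≃-functional ea≃r ea≃r'
...     | refl = h' , dedicated-goodLeaf-transfer (σ a h) (σ' a h') t dedS dedT t∈T good

-- The hypothesis InTr S d is implied by GoodLeaf S d.
proposition4p16 : (S T : Sight) (d : List ℕ) →
    InTr S d → InTr T d →
    (z : ℕ) → RDefined z S → RDefined z T →
    GoodLeaf S d → GoodLeaf T d
proposition4p16 S T d _ d∈T z (_ , _ , _ , _ , dedS) (_ , _ , _ , _ , dedT) =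
  dedicated-goodLeaf-transfer S T d dedS dedT d∈T
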